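{- A graph $G$ has finite corner rank if and only if it has a dismantling ordering.
   Context: All graphs are finite, nonempty and reflexive (every vertex adjacent to itself). For distinct vertices $v,w$ of a graph $H$: $w$ corners $v$ in $H$ if every vertex of $H$ adjacent to $v$ is adjacent to $w$; $w$ strictly corners $v$ in $H$ if moreover some vertex of $H$ adjacent to $w$ is not adjacent to $v$; a strict corner of $H$ is a vertex strictly cornered in $H$ by another vertex. Corner ranking: $G_1=G$, $k=1$. If $G_k$ is a clique, its vertices get rank $k$; stop. Else if $G_k$ has no strict corners, its vertices get rank $\infty$; stop. Else the set $X$ of strict corners of $G_k$ gets rank $k$, $G_{k+1}=G_k-X$ (induced subgraph), increase $k$, repeat. The corner rank of $G$ is the maximum rank ($\infty$ largest); it is finite if it is an integer. A dismantling ordering of $G$ is an ordering $(u_1,\dots,u_n)$ of $V(G)$ such that for each $i\in\{1,\dots,n-1\}$ there is $j>i$ with $u_j$ cornering $u_i$ in the subgraph induced by $\{u_i,\dots,u_n\}$. -}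

module Defs where

open import Data.Nat using (ℕ; suc; _<_; _≤_)
open import Data.Fin using (Fin; toℕ)
open import Data.Maybe using (Maybe; just; nothing)
open import Data.Product using (Σ; ∃; _×_; _,_)
open import Relation.Nullary using (¬_; Dec)
open import Relation.Binary.PropositionalEquality using (_≡_; _≢_)
open import Function.Definitions using (Bijective)

record Graph : Set₁ where
  field
    n        : ℕ
    nonempty : 0 < n
    Adj      : Fin n → Fin n → Set
    Adj?     : (u v : Fin n) → Dec (Adj u v)
    Adj-refl : (v : Fin n) → Adj v v
    Adj-sym  : (u v : Fin n) → Adj u v → Adj v u

module _ (G : Graph) where
  open Graph G

  -- A vertex subset (inducing the subgraph H = G[S]).
  VSet : Set₁
  VSet = Fin n → Set

  Corners : VSet → Fin n → Fin n → Set
  Corners S w v =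
    S v × S w × v ≢ w × ((x : Fin n) → S x → Adj x v → Adj x w)

  StrictlyCorners : VSet → Fin n → Fin n → Set
  StrictlyCorners S w v =
    Corners S w v × ∃ λ x → S x × Adj x w × ¬ Adj x v

  StrictCorner : VSet → Fin n → Set
  StrictCorner S v = ∃ λ w → StrictlyCorners S w v

  IsClique : VSet → Set
  IsClique S = (u v : Fin n) → S u → S v → Adj u v

  HasStrictCorner : VSet → Set
  HasStrictCorner S = ∃ λ v → S v × StrictCorner S v

  RemoveStrictCorners : VSet → VSet
  RemoveStrictCorners S v = S v × ¬ StrictCorner S v

  -- Ranks: just k = the integer k, nothing = ∞.
  -- CornerRanking k S ρ : running the corner ranking procedure from stage k
  -- on G_k = G[S] assigns rank ρ v to each vertex v ∈ S.
  data CornerRanking (k : ℕ) (S : VSet) (ρ : Fin n → Maybe ℕ) : Set₁ where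
    clique : IsClique S
           → ((v : Fin n) → S v → ρ v ≡ just k)
           → CornerRanking k S ρ
    stuck  : ¬ IsClique S → ¬ HasStrictCorner S
           → ((v : Fin n) → S v → ρ v ≡ nothing)
           → CornerRanking k S ρ
    step   : ¬ IsClique S → HasStrictCorner S
           → ((v : Fin n) → S v → StrictCorner S v → ρ v ≡ just k)
           → CornerRanking (suc k) (RemoveStrictCorners S) ρ
           → CornerRanking k S ρ

  -- The corner rank (maximum rank, ∞ largest) is finite iff no vertex gets rank ∞.
  HasFiniteCornerRank : Set₁
  HasFiniteCornerRank =
    Σ (Fin n → Maybe ℕ) λ ρ →
      CornerRanking 1 (λ _ → Fin n) ρ × ((v : Fin n) → ρ v ≢ nothing)

  -- A dismantling ordering (u_0, …, u_{n-1}) given as a bijection u : Fin n → Fin n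
  -- (0-indexed).  Suffix i = {u_i, …, u_{n-1}}.
  Suffix : (Fin n → Fin n) → Fin n → VSet
  Suffix u i v = ∃ λ k → toℕ i ≤ toℕ k × u k ≡ v

  IsDismantlingOrdering : (Fin n → Fin n) → Set
  IsDismantlingOrdering u =
    Bijective _≡_ _≡_ u ×
    ((i : Fin n) → suc (toℕ i) < n →
      ∃ λ j → toℕ i < toℕ j × Corners (Suffix u i) (u j) (u i))

  HasDismantlingOrdering : Set
  HasDismantlingOrdering = ∃ λ u → IsDismantlingOrdering u

-- (⇒) Each strict corner of a stage G_k is cornered by a vertex of G_{k+1}: following strict
-- cornerings from it strictly shrinks its set of non-neighbours, so the chain stops at a vertex that
-- is not a strict corner.  Hence a dismantling of G_{k+1} extends to one of G_k by first removing the
-- strict corners, and the last stage is a clique.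
-- (⇐) Sending each strict corner of G_k to such a vertex is a retraction G_k → G_{k+1}, so every stage
-- is a retract of G.  A retract H of a dismantlable graph D without strict corners is a clique, by
-- induction along the dismantling of D: if the removed vertex v is the image of some h ∈ H, then either
-- the retraction sends the vertex cornering v back to h, and h can be re-embedded there, or it sends
-- it to a twin of h, and h can be dropped.  So the ranking never gets stuck.

module Submission where

open import Defs
open import Data.Bool using (if_then_else_)
open import Data.Empty using (⊥-elim)
open import Data.Fin using (Fin; toℕ; fromℕ<) renaming (zero to fz; suc to fs)
open import Data.Fin.Properties using (_≟_; all?; any?; toℕ-injective; toℕ-fromℕ<; toℕ<n; injective⇒≤)
open import Data.Fin.Subset using (Subset; ∣_∣; inside; outside; _∈_)
open import Data.Fin.Subset.Properties using (p⊂q⇒∣p∣<∣q∣)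
open import Data.Maybe using (Maybe; just; nothing)
open import Data.Nat using (ℕ; zero; suc; pred; >-nonZero; _+_; _<_; _≤_; z≤n; s≤s; z<s; s<s)
import Data.Nat.Properties as ℕₚ
open import Data.Nat.Induction using (<-wellFounded)
open import Data.Product using (Σ; ∃; _×_; _,_; proj₁; proj₂)
open import Function using (_∘_)
open import Data.Vec using (tabulate)
open import Data.Vec.Properties using (lookup∘tabulate; []=⇒lookup; lookup⇒[]=)
open import Induction.WellFounded using (Acc; acc)
open import Relation.Nullary using (¬_; Dec; yes; no; does)
open import Relation.Nullary.Decidable using (_×-dec_; _→-dec_; ¬?)
open import Relation.Binary.PropositionalEquality using (_≡_; _≢_; refl; sym; trans; cong; subst)

toSubset : ∀ {m} {P : Fin m → Set} → (∀ x → Dec (P x)) → Subset m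
toSubset P? = tabulate λ x → if does (P? x) then inside else outside

count : ∀ {m} {P : Fin m → Set} → (∀ x → Dec (P x)) → ℕ
count P? = ∣ toSubset P? ∣

module _ {m} {P : Fin m → Set} (P? : ∀ x → Dec (P x)) where

  ∈-toSubset⁺ : ∀ {x} → P x → x ∈ toSubset P?
  ∈-toSubset⁺ {x} px = lookup⇒[]= x _ (trans (lookup∘tabulate _ x) (inside-if (P? x)))
    where
    inside-if : (d : Dec (P x)) → (if does d then inside else outside) ≡ inside
    inside-if (yes _)   = refl
    inside-if (no ¬px) = ⊥-elim (¬px px)

  ∈-toSubset⁻ : ∀ {x} → x ∈ toSubset P? → P x
  ∈-toSubset⁻ {x} x∈ with P? x | trans (sym (lookup∘tabulate _ x)) ([]=⇒lookup x∈)
  ... | yes px | _ = px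
  ... | no _   | ()

count-< : ∀ {m} {P Q : Fin m → Set} (P? : ∀ x → Dec (P x)) (Q? : ∀ x → Dec (Q x)) →
          (∀ x → P x → Q x) → ∀ {x} → Q x → ¬ P x → count P? < count Q?
count-< P? Q? P⊆Q qx ¬px = p⊂q⇒∣p∣<∣q∣
  ( (λ x∈P → ∈-toSubset⁺ Q? (P⊆Q _ (∈-toSubset⁻ P? x∈P)))
  , _ , ∈-toSubset⁺ Q? qx , λ x∈P → ¬px (∈-toSubset⁻ P? x∈P))

module _ (G : Graph) where
  open Graph G

  Full : VSet G
  Full _ = Fin n

  _⊆_ : VSet G → VSet G → Set
  S ⊆ T = ∀ x → S x → T x

  _-_ : VSet G → Fin n → VSet G
  (S - v) x = S x × x ≢ v

  DecSet : VSet G → Set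
  DecSet S = ∀ v → Dec (S v)

  Dominates : VSet G → Fin n → Fin n → Set
  Dominates S w v = ∀ x → S x → Adj x v → Adj x w

  Hom : VSet G → (Fin n → Fin n) → Set
  Hom S f = ∀ x y → S x → S y → Adj x y → Adj (f x) (f y)

  Corners-restrict : ∀ {S T w v} → T ⊆ S → T v → T w → Corners G S w v → Corners G T w v
  Corners-restrict T⊆S Tv Tw (_ , _ , v≢w , dom) = Tv , Tw , v≢w , λ x Tx → dom x (T⊆S x Tx)

  Dominates? : ∀ {S} → DecSet S → ∀ w v → Dec (Dominates S w v)
  Dominates? S? w v = all? λ x → S? x →-dec Adj? x v →-dec Adj? x w

  Corners? : ∀ {S} → DecSet S → ∀ w v → Dec (Corners G S w v)
  Corners? S? w v = S? v ×-dec S? w ×-dec ¬? (v ≟ w) ×-dec Dominates? S? w v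

  StrictCorner? : ∀ {S} → DecSet S → DecSet (StrictCorner G S)
  StrictCorner? S? v = any? λ w →
    Corners? S? w v ×-dec any? (λ x → S? x ×-dec Adj? x w ×-dec ¬? (Adj? x v))

  RemoveStrictCorners? : ∀ {S} → DecSet S → DecSet (RemoveStrictCorners G S)
  RemoveStrictCorners? S? v = S? v ×-dec ¬? (StrictCorner? S? v)

  HasStrictCorner? : ∀ {S} → DecSet S → Dec (HasStrictCorner G S)
  HasStrictCorner? S? = any? λ v → S? v ×-dec StrictCorner? S? v

  IsClique? : ∀ {S} → DecSet S → Dec (IsClique G S)
  IsClique? S? = all? λ u → all? λ v → S? u →-dec S? v →-dec Adj? u v

  -- Along a chain of strict cornerings the set of non-neighbours in S strictly shrinks.
  non-strict-dominator : ∀ {S} → DecSet S → ∀ v → S v →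
                         ∃ λ w → RemoveStrictCorners G S w × Dominates S w v
  non-strict-dominator {S} S? v Sv = climb v Sv (λ _ _ x~v → x~v) (<-wellFounded _)
    where
    nonNeighbours : Fin n → ℕ
    nonNeighbours w = count λ x → S? x ×-dec ¬? (Adj? x w)

    climb : ∀ w → S w → Dominates S w v → Acc _<_ (nonNeighbours w) →
            ∃ λ w → RemoveStrictCorners G S w × Dominates S w v
    climb w Sw w≽v (acc rec) with StrictCorner? S? w
    ... | no nsc = w , (Sw , nsc) , w≽v
    ... | yes (w′ , (_ , Sw′ , _ , w′≽w) , x , Sx , x~w′ , x≁w) =
      climb w′ Sw′ (λ y Sy y~v → w′≽w y Sy (w≽v y Sy y~v)) (rec fewer)
      where
      fewer : nonNeighbours w′ < nonNeighbours w
      fewer = count-< (λ y → S? y ×-dec ¬? (Adj? y w′)) (λ y → S? y ×-dec ¬? (Adj? y w))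
                      (λ y (Sy , y≁w′) → Sy , λ y~w → y≁w′ (w′≽w y Sy y~w))
                      (Sx , x≁w) (λ (_ , x≁w′) → x≁w′ x~w′)

  strict-corner-cornered-by-non-strict : ∀ {S} → DecSet S → ∀ v → S v → StrictCorner G S v →
    ∃ λ w → RemoveStrictCorners G S w × Corners G S w v
  strict-corner-cornered-by-non-strict S? v Sv sc with non-strict-dominator S? v Sv
  ... | w , (Sw , nsc) , w≽v = w , (Sw , nsc) , Sv , Sw , (λ { refl → nsc sc }) , w≽v

  non-strict-corner-twin : ∀ {S h h′} → S h → S h′ → h ≢ h′ → ¬ StrictCorner G S h →
                           Dominates S h′ h → Dominates S h h′
  non-strict-corner-twin {h = h} Sh Sh′ h≢h′ nsc h′≽h x Sx x~h′ with Adj? x h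
  ... | yes x~h = x~h
  ... | no x≁h  = ⊥-elim (nsc (_ , (Sh , Sh′ , h≢h′ , h′≽h) , x , Sx , x~h′ , x≁h))

  data Dismantling : ℕ → VSet G → Set₁ where
    single : ∀ {S} v → S v → (∀ x → S x → x ≡ v) → Dismantling 1 S
    remove : ∀ {c S} v w → Corners G S w v → Dismantling c (S - v) → Dismantling (suc c) S

  Dismantlable : VSet G → Set₁
  Dismantlable S = ∃ λ c → Dismantling c S

  Dismantling-resp : ∀ {c S T} → S ⊆ T → T ⊆ S → Dismantling c S → Dismantling c T
  Dismantling-resp S⊆T T⊆S (single v Sv unique) = single v (S⊆T v Sv) λ x Tx → unique x (T⊆S x Tx)
  Dismantling-resp S⊆T T⊆S (remove v w cor d) =
    remove v w (Corners-restrict T⊆S (S⊆T v (proj₁ cor)) (S⊆T w (proj₁ (proj₂ cor))) cor)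
           (Dismantling-resp (λ x (Sx , x≢v) → S⊆T x Sx , x≢v) (λ x (Tx , x≢v) → T⊆S x Tx , x≢v) d)

  CorneredFrom : VSet G → VSet G → Set
  CorneredFrom R T = ∀ v → T v → ¬ R v → ∃ λ w → R w × Corners G T w v

  -- The vertices of T outside R can be removed first, in any order.
  extend : ∀ {R T} → DecSet R → DecSet T → R ⊆ T → CorneredFrom R T → Dismantlable R → Dismantlable T
  extend {R} R? T? R⊆T hyp (_ , dR) = go T? R⊆T hyp (<-wellFounded _)
    where
    go : ∀ {T} (T? : DecSet T) → R ⊆ T → CorneredFrom R T →
         Acc _<_ (count λ x → T? x ×-dec ¬? (R? x)) → Dismantlable T
    go {T} T? R⊆T hyp (acc rec) with any? (λ x → T? x ×-dec ¬? (R? x))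
    ... | no none = _ , Dismantling-resp R⊆T T⊆R dR
      where
      T⊆R : T ⊆ R
      T⊆R x Tx with R? x
      ... | yes Rx = Rx
      ... | no ¬Rx = ⊥-elim (none (x , Tx , ¬Rx))
    ... | yes (x , Tx , ¬Rx) with hyp x Tx ¬Rx | go (λ y → T? y ×-dec ¬? (y ≟ x)) R⊆T-x hyp-x (rec fewer)
      where
      R⊆T-x : R ⊆ (T - x)
      R⊆T-x y Ry = R⊆T y Ry , λ { refl → ¬Rx Ry }
      hyp-x : CorneredFrom R (T - x)
      hyp-x y (Ty , y≢x) ¬Ry with hyp y Ty ¬Ry
      ... | w , Rw , cor = w , Rw , Corners-restrict (λ _ → proj₁) (Ty , y≢x) (R⊆T-x w Rw) cor
      fewer : count (λ y → (T? y ×-dec ¬? (y ≟ x)) ×-dec ¬? (R? y)) < count (λ y → T? y ×-dec ¬? (R? y))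
      fewer = count-< (λ y → (T? y ×-dec ¬? (y ≟ x)) ×-dec ¬? (R? y)) (λ y → T? y ×-dec ¬? (R? y))
                      (λ y ((Ty , _) , ¬Ry) → Ty , ¬Ry) (Tx , ¬Rx) λ ((_ , x≢x) , _) → x≢x refl
    ... | w , Rw , cor | _ , d = _ , remove x w cor d

  -- Finite corner rank gives a dismantling

  ranking⇒dismantlable : ∀ {k S ρ} → CornerRanking G k S ρ → DecSet S → (∃ λ v → S v) →
                         (∀ v → S v → ρ v ≢ nothing) → Dismantlable S
  ranking⇒dismantlable {S = S} (clique cl _) S? (v , Sv) _ =
    extend (_≟ v) S? (λ { x refl → Sv }) cornered-by-v (_ , single v refl λ _ x≡v → x≡v)
    where
    cornered-by-v : CorneredFrom (_≡ v) S
    cornered-by-v x Sx x≢v = v , refl , Sx , Sv , x≢v , λ y Sy _ → cl y v Sy Sv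
  ranking⇒dismantlable (stuck _ _ ranks) _ (v , Sv) finite = ⊥-elim (finite v Sv (ranks v Sv))
  ranking⇒dismantlable {S = S} (step _ _ _ next) S? (v , Sv) finite =
    extend (RemoveStrictCorners? S?) S? (λ _ → proj₁) strict-corners-cornered
      (ranking⇒dismantlable next (RemoveStrictCorners? S?) kept-vertex λ x kept → finite x (proj₁ kept))
    where
    kept-vertex : ∃ λ w → RemoveStrictCorners G S w
    kept-vertex = let w , kept , _ = non-strict-dominator S? v Sv in w , kept

    strict-corners-cornered : CorneredFrom (RemoveStrictCorners G S) S
    strict-corners-cornered x Sx ¬kept with StrictCorner? S? x
    ... | yes sc  = strict-corner-cornered-by-non-strict S? x Sx sc
    ... | no nsc = ⊥-elim (¬kept (Sx , nsc))

  -- Dismantlings and dismantling orderings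

  vertex : ∀ {c S} → Dismantling c S → Fin c → Fin n
  vertex (single v _ _)   fz     = v
  vertex (remove v _ _ _) fz     = v
  vertex (remove _ _ _ d) (fs i) = vertex d i

  vertex-∈ : ∀ {c S} (d : Dismantling c S) i → S (vertex d i)
  vertex-∈ (single _ Sv _)            fz     = Sv
  vertex-∈ (remove _ _ (Sv , _) _)    fz     = Sv
  vertex-∈ (remove _ _ _ d)           (fs i) = proj₁ (vertex-∈ d i)

  vertex-surjective : ∀ {c S} (d : Dismantling c S) x → S x → ∃ λ i → vertex d i ≡ x
  vertex-surjective (single _ _ unique) x Sx = fz , sym (unique x Sx)
  vertex-surjective (remove v _ _ d) x Sx with x ≟ v
  ... | yes refl = fz , refl
  ... | no x≢v   = let i , eq = vertex-surjective d x (Sx , x≢v) in fs i , eq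

  vertex-injective : ∀ {c S} (d : Dismantling c S) {i j} → vertex d i ≡ vertex d j → i ≡ j
  vertex-injective (single _ _ _)   {fz}   {fz}   _  = refl
  vertex-injective (remove _ _ _ _) {fz}   {fz}   _  = refl
  vertex-injective (remove _ _ _ d) {fz}   {fs j} eq = ⊥-elim (proj₂ (vertex-∈ d j) (sym eq))
  vertex-injective (remove _ _ _ d) {fs i} {fz}   eq = ⊥-elim (proj₂ (vertex-∈ d i) eq)
  vertex-injective (remove _ _ _ d) {fs i} {fs j} eq = cong fs (vertex-injective d eq)

  Later : ∀ {c S} → Dismantling c S → Fin c → VSet G
  Later d i x = ∃ λ k → toℕ i ≤ toℕ k × vertex d k ≡ x

  vertex-cornered : ∀ {c S} (d : Dismantling c S) i → suc (toℕ i) < c →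
                    ∃ λ j → toℕ i < toℕ j × Corners G (Later d i) (vertex d j) (vertex d i)
  vertex-cornered (single _ _ _) fz (s<s ())
  vertex-cornered (remove v w cor d) fz _ with vertex-surjective d w (proj₁ (proj₂ cor) , λ w≡v → proj₁ (proj₂ (proj₂ cor)) (sym w≡v))
  ... | j , refl = fs j , z<s ,
      Corners-restrict (λ { _ (k , _ , refl) → vertex-∈ (remove v _ cor d) k }) (fz , z≤n , refl) (fs j , z≤n , refl) cor
  vertex-cornered (remove v w cor d) (fs i) (s<s lt) with vertex-cornered d i lt
  ... | j , i<j , cor′ = fs j , s<s i<j ,
      Corners-restrict (λ { _ (fs k , s≤s i≤k , eq) → k , i≤k , eq }) (fs i , ℕₚ.≤-refl , refl) (fs j , s≤s (ℕₚ.<⇒≤ i<j) , refl) cor′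

  module _ {c} (d : Dismantling c Full) where
    private
      index : Fin n → Fin c
      index y = proj₁ (vertex-surjective d y y)

      vertex∘index : ∀ y → vertex d (index y) ≡ y
      vertex∘index y = proj₂ (vertex-surjective d y y)

    Dismantling-size : c ≡ n
    Dismantling-size = ℕₚ.≤-antisym (injective⇒≤ (vertex-injective d)) (injective⇒≤ {f = index} index-injective)
      where
      index-injective : ∀ {x y} → index x ≡ index y → x ≡ y
      index-injective {x} {y} eq = trans (sym (vertex∘index x)) (trans (cong (vertex d) eq) (vertex∘index y))

    dismantling⇒ordering : c ≡ n → HasDismantlingOrdering G
    dismantling⇒ordering refl =
      vertex d , (vertex-injective d , λ y → index y , λ { refl → vertex∘index y }) , vertex-cornered d

  module _ {u : Fin n → Fin n} (ord : IsDismantlingOrdering G u) where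
    private
      u-injective : ∀ {i j} → u i ≡ u j → i ≡ j
      u-injective = proj₁ (proj₁ ord)

      u-surjective : ∀ y → ∃ λ i → u i ≡ y
      u-surjective y = let i , ui≡y = proj₂ (proj₁ ord) y in i , ui≡y refl

    Suffix-next : ∀ {i} (lt : suc (toℕ i) < n) → Suffix G u (fromℕ< lt) ⊆ (Suffix G u i - u i)
    Suffix-next {i} lt _ (k , i′≤k , refl) =
      (k , ℕₚ.<⇒≤ i<k , refl) , λ uk≡ui → ℕₚ.<⇒≢ i<k (cong toℕ (sym (u-injective uk≡ui)))
      where
      i<k : toℕ i < toℕ k
      i<k = subst (_≤ toℕ k) (toℕ-fromℕ< lt) i′≤k

    Suffix-next⁻ : ∀ {i} (lt : suc (toℕ i) < n) → (Suffix G u i - u i) ⊆ Suffix G u (fromℕ< lt)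
    Suffix-next⁻ {i} lt _ ((k , i≤k , refl) , uk≢ui) =
      k , subst (_≤ toℕ k) (sym (toℕ-fromℕ< lt)) (ℕₚ.≤∧≢⇒< i≤k λ i≡k → uk≢ui (cong u (sym (toℕ-injective i≡k)))) , refl

    suffix-dismantling : ∀ m (i : Fin n) → suc (m + toℕ i) ≡ n → Dismantling (suc m) (Suffix G u i)
    suffix-dismantling zero i i+1≡n = single (u i) (i , ℕₚ.≤-refl , refl) last
      where
      last : ∀ x → Suffix G u i x → x ≡ u i
      last _ (k , i≤k , refl) = cong u (toℕ-injective (ℕₚ.≤-antisym k≤i i≤k))
        where
        k≤i : toℕ k ≤ toℕ i
        k≤i = ℕₚ.m<1+n⇒m≤n (subst (toℕ k <_) (sym i+1≡n) (toℕ<n k))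
    suffix-dismantling (suc m) i i+m+2≡n =
      let j , _ , cor = proj₂ ord i lt in
      remove (u i) (u j) cor
        (Dismantling-resp (Suffix-next lt) (Suffix-next⁻ lt) (suffix-dismantling m (fromℕ< lt) next+m+1≡n))
      where
      lt : suc (toℕ i) < n
      lt = subst (suc (toℕ i) <_) i+m+2≡n (s≤s (s≤s (ℕₚ.m≤n+m (toℕ i) m)))
      next+m+1≡n : suc (m + toℕ (fromℕ< lt)) ≡ n
      next+m+1≡n = trans (cong (λ k → suc (m + k)) (toℕ-fromℕ< lt)) (trans (cong suc (ℕₚ.+-suc m (toℕ i))) i+m+2≡n)

    ordering⇒dismantling : Dismantlable Full
    ordering⇒dismantling = _ , Dismantling-resp (λ x _ → x) (λ x _ → from-first x) (suffix-dismantling (pred n) i₀ size)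
      where
      i₀ : Fin n
      i₀ = fromℕ< nonempty
      size : suc (pred n + toℕ i₀) ≡ n
      size = trans (cong (λ k → suc (pred n + k)) (toℕ-fromℕ< nonempty))
                   (trans (cong suc (ℕₚ.+-identityʳ (pred n))) (ℕₚ.suc-pred n {{>-nonZero nonempty}}))
      from-first : ∀ x → Suffix G u i₀ x
      from-first x = let k , uk≡x = u-surjective x in k , subst (_≤ toℕ k) (sym (toℕ-fromℕ< nonempty)) z≤n , uk≡x

  -- Retracts of dismantlable graphs

  record Retraction (D H : VSet G) : Set where
    field
      ι π   : Fin n → Fin n
      ι-∈   : ∀ h → H h → D (ι h)
      π-∈   : ∀ x → D x → H (π x)
      π∘ι   : ∀ h → H h → π (ι h) ≡ h
      ι-hom : Hom H ι
      π-hom : Hom D π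

    ι-injective : ∀ {a b} → H a → H b → ι a ≡ ι b → a ≡ b
    ι-injective {a} {b} Ha Hb eq = trans (sym (π∘ι a Ha)) (trans (cong π eq) (π∘ι b Hb))

  Retraction-∘ : ∀ {D S T} → Retraction D S → Retraction S T → Retraction D T
  Retraction-∘ R₁ R₂ = record
    { ι = λ h → R₁.ι (R₂.ι h) ; π = λ x → R₂.π (R₁.π x)
    ; ι-∈ = λ h Th → R₁.ι-∈ _ (R₂.ι-∈ h Th)
    ; π-∈ = λ x Dx → R₂.π-∈ _ (R₁.π-∈ x Dx)
    ; π∘ι = λ h Th → trans (cong R₂.π (R₁.π∘ι _ (R₂.ι-∈ h Th))) (R₂.π∘ι h Th)
    ; ι-hom = λ x y Tx Ty x~y → R₁.ι-hom _ _ (R₂.ι-∈ x Tx) (R₂.ι-∈ y Ty) (R₂.ι-hom x y Tx Ty x~y)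
    ; π-hom = λ x y Dx Dy x~y → R₂.π-hom _ _ (R₁.π-∈ x Dx) (R₁.π-∈ y Dy) (R₁.π-hom x y Dx Dy x~y)
    }
    where
    module R₁ = Retraction R₁
    module R₂ = Retraction R₂

  identity-retraction : Retraction Full Full
  identity-retraction = record
    { ι = λ x → x ; π = λ x → x ; ι-∈ = λ _ x → x ; π-∈ = λ _ x → x
    ; π∘ι = λ _ _ → refl ; ι-hom = λ _ _ _ _ a → a ; π-hom = λ _ _ _ _ a → a }

  strict-corner-retraction : ∀ {S} → DecSet S → Retraction S (RemoveStrictCorners G S)
  strict-corner-retraction {S} S? = record
    { ι = λ h → h ; π = π
    ; ι-∈ = λ _ → proj₁
    ; π-∈ = λ y Sy → proj₁ (π-spec y Sy)
    ; π∘ι = π-fixes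
    ; ι-hom = λ _ _ _ _ h~h′ → h~h′
    ; π-hom = λ y₁ y₂ S₁ S₂ y₁~y₂ →
        Adj-sym _ _ (proj₂ (π-spec y₁ S₁) _ (proj₁ (proj₁ (π-spec y₂ S₂)))
                            (Adj-sym _ _ (proj₂ (π-spec y₂ S₂) y₁ S₁ y₁~y₂)))
    }
    where
    π : Fin n → Fin n
    π y with S? y
    ... | no _ = y
    ... | yes Sy with StrictCorner? S? y
    ...   | no _  = y
    ...   | yes _ = proj₁ (non-strict-dominator S? y Sy)

    π-spec : ∀ y → S y → RemoveStrictCorners G S (π y) × Dominates S (π y) y
    π-spec y Sy with S? y
    ... | no ¬Sy = ⊥-elim (¬Sy Sy)
    ... | yes Sy′ with StrictCorner? S? y
    ...   | no nsc = (Sy′ , nsc) , λ _ _ x~y → x~y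
    ...   | yes _  = proj₂ (non-strict-dominator S? y Sy′)

    π-fixes : ∀ y → RemoveStrictCorners G S y → π y ≡ y
    π-fixes y (Sy , nsc) with S? y
    ... | no _ = refl
    ... | yes _ with StrictCorner? S? y
    ...   | no _   = refl
    ...   | yes sc = ⊥-elim (nsc sc)

  module _ {D H} (R : Retraction D H) where
    open Retraction R

    ι-avoids : ∀ {h v} → H h → ι h ≡ v → ∀ x → H x → x ≢ h → ι x ≢ v
    ι-avoids Hh ιh≡v x Hx x≢h ιx≡v = x≢h (ι-injective Hx Hh (trans ιx≡v (sym ιh≡v)))

    Retraction-avoid : ∀ {v} → (∀ h → H h → ι h ≢ v) → Retraction (D - v) H
    Retraction-avoid avoid = record
      { ι = ι ; π = π
      ; ι-∈ = λ h Hh → ι-∈ h Hh , avoid h Hh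
      ; π-∈ = λ x Dx → π-∈ x (proj₁ Dx)
      ; π∘ι = π∘ι
      ; ι-hom = ι-hom
      ; π-hom = λ x y Dx Dy → π-hom x y (proj₁ Dx) (proj₁ Dy)
      }

    -- h is re-embedded at w, which corners its old image v.
    Retraction-reroute : ∀ {v w h} → Corners G D w v → H h → ι h ≡ v → π w ≡ h → Retraction (D - v) H
    Retraction-reroute {v} {w} {h} (_ , Dw , v≢w , w≽v) Hh ιh≡v πw≡h = record
      { ι = ι′ ; π = π
      ; ι-∈ = ι′-∈
      ; π∘ι = π∘ι′
      ; π-∈ = λ x Dx → π-∈ x (proj₁ Dx)
      ; ι-hom = ι′-hom
      ; π-hom = λ x y Dx Dy → π-hom x y (proj₁ Dx) (proj₁ Dy)
      }
      where
      ι′ : Fin n → Fin n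
      ι′ x = if does (x ≟ h) then w else ι x

      ι′-∈ : ∀ x → H x → (D - v) (ι′ x)
      ι′-∈ x Hx with x ≟ h
      ... | yes _   = Dw , λ w≡v → v≢w (sym w≡v)
      ... | no x≢h = ι-∈ x Hx , ι-avoids Hh ιh≡v x Hx x≢h

      π∘ι′ : ∀ x → H x → π (ι′ x) ≡ x
      π∘ι′ x Hx with x ≟ h
      ... | yes refl = πw≡h
      ... | no _     = π∘ι x Hx

      ι-adjacent-to-v : ∀ x → H x → Adj x h → Adj (ι x) w
      ι-adjacent-to-v x Hx x~h = w≽v (ι x) (ι-∈ x Hx) (subst (Adj (ι x)) ιh≡v (ι-hom x h Hx Hh x~h))

      ι′-hom : Hom H ι′
      ι′-hom x y Hx Hy x~y with x ≟ h | y ≟ h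
      ... | yes _    | yes _    = Adj-refl w
      ... | yes refl | no _     = Adj-sym _ _ (ι-adjacent-to-v y Hy (Adj-sym _ _ x~y))
      ... | no _     | yes refl = ι-adjacent-to-v x Hx x~y
      ... | no _     | no _     = ι-hom x y Hx Hy x~y

    π-corner-dominates : ∀ {v w h} → Corners G D w v → H h → ι h ≡ v → Dominates H (π w) h
    π-corner-dominates {w = w} (_ , Dw , _ , w≽v) Hh ιh≡v x Hx x~h = subst (λ y → Adj y (π w)) (π∘ι x Hx)
      (π-hom _ _ (ι-∈ x Hx) Dw (w≽v (ι x) (ι-∈ x Hx) (subst (Adj (ι x)) ιh≡v (ι-hom x _ Hx Hh x~h))))

    -- h is identified with its twin h′, which dominates it.
    Retraction-drop-twin : ∀ {v h h′} → H h → ι h ≡ v → H h′ → h′ ≢ h → Dominates H h′ h → Retraction (D - v) (H - h)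
    Retraction-drop-twin {v} {h} {h′} Hh ιh≡v Hh′ h′≢h h′≽h = record
      { ι = ι ; π = π′
      ; ι-∈ = λ x (Hx , x≢h) → ι-∈ x Hx , ι-avoids Hh ιh≡v x Hx x≢h
      ; π-∈ = π′-∈
      ; π∘ι = π′∘ι
      ; ι-hom = λ x y Hx Hy → ι-hom x y (proj₁ Hx) (proj₁ Hy)
      ; π-hom = π′-hom
      }
      where
      π′ : Fin n → Fin n
      π′ x = if does (π x ≟ h) then h′ else π x

      π′-∈ : ∀ x → (D - v) x → (H - h) (π′ x)
      π′-∈ x (Dx , _) with π x ≟ h
      ... | yes _     = Hh′ , h′≢h
      ... | no πx≢h = π-∈ x Dx , πx≢h

      π′∘ι : ∀ x → (H - h) x → π′ (ι x) ≡ x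
      π′∘ι x (Hx , x≢h) with π (ι x) ≟ h
      ... | yes πιx≡h = ⊥-elim (x≢h (trans (sym (π∘ι x Hx)) πιx≡h))
      ... | no _       = π∘ι x Hx

      π′-hom : Hom (D - v) π′
      π′-hom x y (Dx , _) (Dy , _) x~y with π x ≟ h | π y ≟ h | π-hom x y Dx Dy x~y
      ... | yes _    | yes _    | _       = Adj-refl h′
      ... | yes refl | no _     | πx~πy = Adj-sym _ _ (h′≽h (π y) (π-∈ y Dy) (Adj-sym _ _ πx~πy))
      ... | no _     | yes refl | πx~πy = h′≽h (π x) (π-∈ x Dx) πx~πy
      ... | no _     | no _     | πx~πy = πx~πy

  module _ {H h h′} (Hh : H h) (Hh′ : H h′) (h′≢h : h′ ≢ h) (h′≽h : Dominates H h′ h) (h≽h′ : Dominates H h h′) where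

    no-strict-corner-drop-twin : ¬ HasStrictCorner G H → ¬ HasStrictCorner G (H - h)
    no-strict-corner-drop-twin nsc (y , (Hy , _) , z , (_ , (Hz , _) , y≢z , z≽y) , x , (Hx , _) , x~z , x≁y) =
      nsc (y , Hy , z , (Hy , Hz , y≢z , z≽y-in-H) , x , Hx , x~z , x≁y)
      where
      z≽y-in-H : Dominates H z y
      z≽y-in-H x Hx x~y with x ≟ h
      ... | yes refl = Adj-sym _ _ (h≽h′ z Hz (Adj-sym _ _ (z≽y h′ (Hh′ , h′≢h) (Adj-sym _ _ (h′≽h y Hy (Adj-sym _ _ x~y))))))
      ... | no x≢h   = z≽y x (Hx , x≢h) x~y

    clique-drop-twin : IsClique G (H - h) → IsClique G H
    clique-drop-twin cl a b Ha Hb with a ≟ h | b ≟ h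
    ... | yes refl | yes refl = Adj-refl h
    ... | yes refl | no b≢h  = Adj-sym _ _ (h≽h′ b Hb (cl b h′ (Hb , b≢h) (Hh′ , h′≢h)))
    ... | no a≢h  | yes refl = h≽h′ a Ha (cl a h′ (Ha , a≢h) (Hh′ , h′≢h))
    ... | no a≢h  | no b≢h  = cl a b (Ha , a≢h) (Hb , b≢h)

  retract-clique : ∀ {c D H} → Dismantling c D → DecSet H → Retraction D H → ¬ HasStrictCorner G H → IsClique G H
  retract-clique (single v _ unique) _ R _ x y Hx Hy =
    subst (Adj x) (ι-injective Hx Hy (trans (unique _ (ι-∈ x Hx)) (sym (unique _ (ι-∈ y Hy))))) (Adj-refl x)
    where open Retraction R
  retract-clique {H = H} (remove v w cor d) H? R nsc with any? (λ h → H? h ×-dec (Retraction.ι R h ≟ v))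
  ... | no miss = retract-clique d H? (Retraction-avoid R λ h Hh ιh≡v → miss (h , Hh , ιh≡v)) nsc
  ... | yes (h , Hh , ιh≡v) with Retraction.π R w ≟ h
  ...   | yes πw≡h = retract-clique d H? (Retraction-reroute R cor Hh ιh≡v πw≡h) nsc
  ...   | no πw≢h  = clique-drop-twin Hh Hh′ πw≢h h′≽h h≽h′
      (retract-clique d (λ x → H? x ×-dec ¬? (x ≟ h)) (Retraction-drop-twin R Hh ιh≡v Hh′ πw≢h h′≽h)
                      (no-strict-corner-drop-twin Hh Hh′ πw≢h h′≽h h≽h′ nsc))
    where
    open Retraction R
    Hh′ : H (π w)
    Hh′ = π-∈ w (proj₁ (proj₂ cor))
    h′≽h : Dominates H (π w) h
    h′≽h = π-corner-dominates R cor Hh ιh≡v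
    h≽h′ : Dominates H h (π w)
    h≽h′ = non-strict-corner-twin Hh Hh′ (λ h≡h′ → πw≢h (sym h≡h′)) (λ sc → nsc (h , Hh , sc)) h′≽h

  -- A dismantling gives a finite corner ranking

  FiniteRanking : ℕ → VSet G → Set₁
  FiniteRanking k S = Σ (Fin n → Maybe ℕ) λ ρ → CornerRanking G k S ρ × (∀ v → S v → ρ v ≢ nothing)

  CornerRanking-cong : ∀ {k S ρ ρ′} → (∀ v → S v → ρ v ≡ ρ′ v) → CornerRanking G k S ρ → CornerRanking G k S ρ′
  CornerRanking-cong ρ≗ρ′ (clique cl ranks)      = clique cl λ v Sv → trans (sym (ρ≗ρ′ v Sv)) (ranks v Sv)
  CornerRanking-cong ρ≗ρ′ (stuck ¬cl ¬sc ranks)  = stuck ¬cl ¬sc λ v Sv → trans (sym (ρ≗ρ′ v Sv)) (ranks v Sv)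
  CornerRanking-cong ρ≗ρ′ (step ¬cl sc ranks next) =
    step ¬cl sc (λ v Sv svc → trans (sym (ρ≗ρ′ v Sv)) (ranks v Sv svc)) (CornerRanking-cong (λ v → ρ≗ρ′ v ∘ proj₁) next)

  -- Each stage G_k is a retract of G, so it has a strict corner unless it is a clique.
  finite-ranking : ∀ {c S} → Dismantling c Full → (S? : DecSet S) → Acc _<_ (count S?) →
                   Retraction Full S → ∀ k → FiniteRanking k S
  finite-ranking {S = S} dFull S? (acc rec) R k with IsClique? S?
  ... | yes cl = (λ _ → just k) , clique cl (λ _ _ → refl) , λ _ _ ()
  ... | no ¬cl with HasStrictCorner? S?
  ...   | no ¬hsc = ⊥-elim (¬cl (retract-clique dFull S? R ¬hsc))
  ...   | yes hsc@(v , Sv , sc)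
          with finite-ranking dFull (RemoveStrictCorners? S?)
                 (rec (count-< (RemoveStrictCorners? S?) S? (λ _ → proj₁) Sv λ kept → proj₂ kept sc))
                 (Retraction-∘ R (strict-corner-retraction S?)) (suc k)
  ...     | ρ′ , ranking , finite = ρ , step ¬cl hsc ρ-corner (CornerRanking-cong ρ′≗ρ ranking) , ρ-finite
    where
    ρ : Fin n → Maybe ℕ
    ρ x = if does (StrictCorner? S? x) then just k else ρ′ x

    ρ-corner : ∀ x → S x → StrictCorner G S x → ρ x ≡ just k
    ρ-corner x _ scx with StrictCorner? S? x
    ... | yes _   = refl
    ... | no nscx = ⊥-elim (nscx scx)

    ρ′≗ρ : ∀ x → RemoveStrictCorners G S x → ρ′ x ≡ ρ x
    ρ′≗ρ x (_ , nscx) with StrictCorner? S? x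
    ... | yes scx = ⊥-elim (nscx scx)
    ... | no _    = refl

    ρ-finite : ∀ x → S x → ρ x ≢ nothing
    ρ-finite x Sx with StrictCorner? S? x
    ... | yes _   = λ ()
    ... | no nscx = finite x (Sx , nscx)

lemma6p6 : (G : Graph) → (HasFiniteCornerRank G → HasDismantlingOrdering G) × (HasDismantlingOrdering G → HasFiniteCornerRank G)
lemma6p6 G = rank⇒ordering , ordering⇒rank
  where
  v₀ : Fin (Graph.n G)
  v₀ = fromℕ< (Graph.nonempty G)

  rank⇒ordering : HasFiniteCornerRank G → HasDismantlingOrdering G
  rank⇒ordering (_ , ranking , finite) =
    let _ , d = ranking⇒dismantlable G ranking (λ v → yes v) (v₀ , v₀) (λ v _ → finite v)
    in dismantling⇒ordering G d (Dismantling-size G d)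

  ordering⇒rank : HasDismantlingOrdering G → HasFiniteCornerRank G
  ordering⇒rank (_ , ord) =
    let _ , d = ordering⇒dismantling G ord
        ρ , ranking , finite = finite-ranking G d (λ v → yes v) (<-wellFounded _) (identity-retraction G) 1
    in ρ , ranking , λ v → finite v v
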